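{- Let $k$ be a positive integer, $t$ an integer and $p$ an odd prime. Then there are exactly $p-1$ integers $n\in\{0,1,\dots,p^k(p-1)-1\}$ such that $p^k$ divides $n2^n-t$. -}

module Defs where

open import Data.Nat as ℕ using (ℕ)
open import Data.Integer as ℤ using (ℤ; +_; ∣_∣)
open import Data.Integer.Divisibility using (_∣_)
import Data.Nat.Divisibility as ℕD
open import Data.List using (List; filter; upTo)
open import Relation.Nullary using (Dec)

expr : ℕ → ℤ → ℤ
expr n t = (+ n) ℤ.* (+ (2 ℕ.^ n)) ℤ.- t

_∣ℤ?_ : (d z : ℤ) → Dec (d ∣ z)
d ∣ℤ? z = ∣ d ∣ ℕD.∣? ∣ z ∣

solutions : ℕ → ℕ → ℤ → List ℕ
solutions p k t =
  filter (λ n → (+ (p ℕ.^ k)) ∣ℤ? expr n t) (upTo ((p ℕ.^ k) ℕ.* (p ℕ.∸ 1)))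

{-# OPTIONS --safe #-}
module Submission where

open import Defs
open import Data.Nat using (ℕ; _∸_; _≥_)
open import Data.Nat.Primality using (Prime)
open import Data.Integer using (ℤ)
open import Data.List using (length)
open import Relation.Binary.PropositionalEquality using (_≡_; _≢_)

open import Data.Product.Base using (_,_; _×_; ∃-syntax)
open import Data.Sum.Base using ([_,_])
open import Function.Base using (_∘_; id)
open import Function.Bundles using (_⇔_; mk⇔; Equivalence)
open import Relation.Binary.PropositionalEquality
  using (refl; sym; trans; cong; cong₂; subst; subst₂; module ≡-Reasoning)
open import Relation.Nullary using (Dec; yes; no; ¬_; contradiction)
open import Relation.Unary using (Pred; Decidable)

-- Write M k = p^k (p − 1). Fermat's little theorem 2^(p−1) ≡ 1 (mod p), lifted with the
-- factorisation a^p − 1 = (a − 1)(1 + a + ⋯ + a^(p−1)), whose second factor is ≡ p ≡ 0 (mod p)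
-- when a ≡ 1 (mod p), gives 2^(M k) ≡ 1 (mod p^(k+1)). Hence, for n < M k and j < p,
-- (j M k + n) 2^(j M k + n) ≡ n 2^n + j M k 2^n (mod p^(k+1)), and p^k divides j M k 2^n.
-- So j M k + n solves the congruence modulo p^(k+1) only if n solves it modulo p^k, and if
-- n 2^n − t = c p^k the condition on j is c + j (p − 1) 2^n ≡ 0 (mod p), which has exactly one
-- solution j < p since p ∤ (p − 1) 2^n. Splitting [0, M (k+1)) into p blocks of length M k, the
-- number of solutions is therefore independent of k, and for k = 0 it is M 0 = p − 1.

module _ where

  open import Data.Nat.Base
  open import Data.Nat.Properties
  open import Data.Nat.Divisibility using (_∣_; _∤_; ∣m∣n⇒∣m+n; _∣0; m∣m*n; >⇒∤)
  open import Data.Nat.Combinatorics using (_C_; nCn≡1; nCk≡n!/k![n-k]!; k![n∸k]!∣n!)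
  open import Data.Nat.DivMod using (m/n*n≡m)
  open import Data.Nat.Primality
    using (euclidsLemma; prime⇒nonTrivial; prime⇒irreducible; prime[2]; ¬prime[1])
  open import Data.Fin.Base using (toℕ)
  open import Data.List.Base using (filter; applyUpTo)
  open import Algebra.Properties.CommutativeSemigroup +-commutativeSemigroup
    using (interchange)
  import Algebra.Properties.Semiring.Exp +-*-semiring as Exp
  import Algebra.Properties.Semiring.Mult +-*-semiring as Mult
  import Algebra.Properties.Semiring.Sum +-*-semiring as FinSum
  import Algebra.Properties.CommutativeSemiring.Binomial +-*-commutativeSemiring as Binomial

  ∑< : ℕ → (ℕ → ℕ) → ℕ
  ∑< zero    f = 0
  ∑< (suc n) f = f 0 + ∑< n (f ∘ suc)

  syntax ∑< n (λ i → e) = ∑[ i < n ] e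

  ∑-cong : ∀ n {f g : ℕ → ℕ} → (∀ {i} → i < n → f i ≡ g i) → ∑< n f ≡ ∑< n g
  ∑-cong zero    f≗g = refl
  ∑-cong (suc n) f≗g = cong₂ _+_ (f≗g z<s) (∑-cong n (f≗g ∘ s<s))

  ∑-distrib-+ : ∀ n (f g : ℕ → ℕ) → ∑[ i < n ] (f i + g i) ≡ ∑< n f + ∑< n g
  ∑-distrib-+ zero    f g = refl
  ∑-distrib-+ (suc n) f g =
    trans (cong (f 0 + g 0 +_) (∑-distrib-+ n (f ∘ suc) (g ∘ suc))) (interchange (f 0) (g 0) _ _)

  ∑-++ : ∀ m n (f : ℕ → ℕ) → ∑< (m + n) f ≡ ∑< m f + ∑[ i < n ] f (m + i)
  ∑-++ zero    n f = refl
  ∑-++ (suc m) n f = trans (cong (f 0 +_) (∑-++ m n (f ∘ suc))) (sym (+-assoc (f 0) _ _))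

  ∑-suc : ∀ n (f : ℕ → ℕ) → ∑< (suc n) f ≡ ∑< n f + f n
  ∑-suc zero    f = +-identityʳ (f 0)
  ∑-suc (suc n) f = trans (cong (f 0 +_) (∑-suc n (f ∘ suc))) (sym (+-assoc (f 0) _ _))

  ∑-blocks : ∀ m n (f : ℕ → ℕ) → ∑< (m * n) f ≡ ∑[ j < m ] ∑[ i < n ] f (j * n + i)
  ∑-blocks zero    n f = refl
  ∑-blocks (suc m) n f = begin
    ∑< (n + m * n) f
      ≡⟨ ∑-++ n (m * n) f ⟩
    ∑< n f + ∑[ i < m * n ] f (n + i)
      ≡⟨ cong (∑< n f +_) (∑-blocks m n (λ i → f (n + i))) ⟩
    ∑< n f + ∑[ j < m ] ∑[ i < n ] f (n + (j * n + i))
      ≡⟨ cong (∑< n f +_) (∑-cong m λ {j} _ → ∑-cong n λ {i} _ → cong f (sym (+-assoc n (j * n) i))) ⟩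
    ∑< n f + ∑[ j < m ] ∑[ i < n ] f (suc j * n + i)
      ∎
    where open ≡-Reasoning

  ∑-comm : ∀ m n (f : ℕ → ℕ → ℕ) → ∑[ i < m ] ∑[ j < n ] f i j ≡ ∑[ j < n ] ∑[ i < m ] f i j
  ∑-comm zero    n f = sym (∑-zero n)
    where
    ∑-zero : ∀ n → ∑[ _ < n ] 0 ≡ 0
    ∑-zero zero    = refl
    ∑-zero (suc n) = ∑-zero n
  ∑-comm (suc m) n f = trans (cong (∑< n (f 0) +_) (∑-comm m n (f ∘ suc)))
                             (sym (∑-distrib-+ n (f 0) (λ j → ∑[ i < m ] f (suc i) j)))

  ∑-∣ : ∀ {d} n (f : ℕ → ℕ) → (∀ {i} → i < n → d ∣ f i) → d ∣ ∑< n f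
  ∑-∣ zero    f d∣f = _ ∣0
  ∑-∣ (suc n) f d∣f = ∣m∣n⇒∣m+n (d∣f z<s) (∑-∣ n (f ∘ suc) (d∣f ∘ s<s))

  𝟙 : ∀ {a} {A : Set a} → Dec A → ℕ
  𝟙 (yes _) = 1
  𝟙 (no _)  = 0

  𝟙-yes : ∀ {a} {A : Set a} (A? : Dec A) → A → 𝟙 A? ≡ 1
  𝟙-yes (yes _) _ = refl
  𝟙-yes (no ¬a) a = contradiction a ¬a

  𝟙-no : ∀ {a} {A : Set a} (A? : Dec A) → ¬ A → 𝟙 A? ≡ 0
  𝟙-no (yes a) ¬a = contradiction a ¬a
  𝟙-no (no _)  _  = refl

  𝟙-cases : ∀ {a} {A : Set a} (A? : Dec A) {x} → (A → x ≡ 1) → (¬ A → x ≡ 0) → x ≡ 𝟙 A?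
  𝟙-cases (yes a) x≡1 _ = x≡1 a
  𝟙-cases (no ¬a) _ x≡0 = x≡0 ¬a

  count : ∀ {ℓ} {P : Pred ℕ ℓ} → Decidable P → ℕ → ℕ
  count P? n = ∑[ i < n ] 𝟙 (P? i)

  length-filter-applyUpTo : ∀ {a ℓ} {A : Set a} {P : Pred A ℓ} (P? : Decidable P) (f : ℕ → A) n →
                            length (filter P? (applyUpTo f n)) ≡ count (P? ∘ f) n
  length-filter-applyUpTo P? f zero = refl
  length-filter-applyUpTo P? f (suc n) with P? (f 0)
  ... | yes _ = cong suc (length-filter-applyUpTo P? (f ∘ suc) n)
  ... | no _  = length-filter-applyUpTo P? (f ∘ suc) n

  count-all : ∀ {ℓ} {P : Pred ℕ ℓ} (P? : Decidable P) n → (∀ {i} → i < n → P i) → count P? n ≡ n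
  count-all P? zero    _   = refl
  count-all P? (suc n) all = cong₂ _+_ (𝟙-yes (P? 0) (all z<s)) (count-all (P? ∘ suc) n (all ∘ s<s))

  count-none : ∀ {ℓ} {P : Pred ℕ ℓ} (P? : Decidable P) n → (∀ {i} → i < n → ¬ P i) → count P? n ≡ 0
  count-none P? zero    _    = refl
  count-none P? (suc n) none = cong₂ _+_ (𝟙-no (P? 0) (none z<s)) (count-none (P? ∘ suc) n (none ∘ s<s))

  count-unique : ∀ {ℓ} {P : Pred ℕ ℓ} (P? : Decidable P) {n j} → j < n → P j →
                 (∀ {i} → i < n → P i → i ≡ j) → count P? n ≡ 1
  count-unique P? {suc n} {zero} z<s P0 unique =
    cong₂ _+_ (𝟙-yes (P? 0) P0) (count-none (P? ∘ suc) n λ i<n → 1+n≢0 ∘ unique (s<s i<n))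
  count-unique P? {suc n} {suc j} (s<s j<n) Pj unique =
    cong₂ _+_ (𝟙-no (P? 0) (0≢1+n ∘ unique z<s))
              (count-unique (P? ∘ suc) j<n Pj λ i<n → suc-injective ∘ unique (s<s i<n))

  sum-toℕ≡∑ : ∀ n (f : ℕ → ℕ) → FinSum.sum {n} (f ∘ toℕ) ≡ ∑< n f
  sum-toℕ≡∑ zero    f = refl
  sum-toℕ≡∑ (suc n) f = cong (f 0 +_) (sum-toℕ≡∑ n (f ∘ suc))

  semiring-^≡^ : ∀ m n → m Exp.^ n ≡ m ^ n
  semiring-^≡^ m zero    = refl
  semiring-^≡^ m (suc n) = cong (m *_) (semiring-^≡^ m n)

  semiring-×≡* : ∀ m n → m Mult.× n ≡ m * n
  semiring-×≡* zero    n = refl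
  semiring-×≡* (suc m) n = cong (n +_) (semiring-×≡* m n)

  2^n≡∑nCk : ∀ n → 2 ^ n ≡ ∑[ k < suc n ] (n C k)
  2^n≡∑nCk n = begin
    2 ^ n                             ≡⟨ semiring-^≡^ 2 n ⟨
    (1 + 1) Exp.^ n                   ≡⟨ Binomial.theorem n 1 1 ⟩
    Binomial.binomialExpansion 1 1 n  ≡⟨ sum-toℕ≡∑ (suc n) term ⟩
    ∑< (suc n) term                   ≡⟨ ∑-cong (suc n) (λ {k} _ → term≡nCk k) ⟩
    ∑[ k < suc n ] (n C k)            ∎
    where
    open ≡-Reasoning
    term : ℕ → ℕ
    term k = (n C k) Mult.× (1 Exp.^ k * 1 Exp.^ (n ∸ k))
    term≡nCk : ∀ k → term k ≡ n C k
    term≡nCk k rewrite semiring-^≡^ 1 k | semiring-^≡^ 1 (n ∸ k) | ^-zeroˡ k | ^-zeroˡ (n ∸ k) =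
      trans (semiring-×≡* (n C k) 1) (*-identityʳ _)

  prime∤! : ∀ {p m} → Prime p → m < p → p ∤ m !
  prime∤! {p} {zero}  pp _        = >⇒∤ (nonTrivial⇒n>1 p {{prime⇒nonTrivial pp}})
  prime∤! {p} {suc m} pp m<p p∣m! =
    [ >⇒∤ m<p , prime∤! pp (<-trans (n<1+n m) m<p) ] (euclidsLemma (suc m) (m !) pp p∣m!)

  prime∤* : ∀ {p m n} → Prime p → p ∤ m → p ∤ n → p ∤ m * n
  prime∤* {m = m} {n} pp p∤m p∤n p∣mn = [ p∤m , p∤n ] (euclidsLemma m n pp p∣mn)

  prime∤^ : ∀ {p m} → Prime p → p ∤ m → ∀ n → p ∤ m ^ n
  prime∤^ pp p∤m zero    = >⇒∤ (nonTrivial⇒n>1 _ {{prime⇒nonTrivial pp}})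
  prime∤^ pp p∤m (suc n) = prime∤* pp p∤m (prime∤^ pp p∤m n)

  prime∤p∸1 : ∀ {p} → Prime p → p ∤ p ∸ 1
  prime∤p∸1 {suc (suc r)} _ = >⇒∤ (n<1+n (suc r))

  odd-prime∤2 : ∀ {p} → Prime p → p ≢ 2 → p ∤ 2
  odd-prime∤2 pp p≢2 p∣2 = [ (λ { refl → ¬prime[1] pp }) , p≢2 ] (prime⇒irreducible prime[2] p∣2)

  prime∣pCk : ∀ {p k} → Prime p → 0 < k → k < p → p ∣ p C k
  prime∣pCk {suc q} {k} pp 0<k k<p =
    [ id , (λ p∣k!*[p∸k]! → contradiction p∣k!*[p∸k]! p∤k!*[p∸k]!) ]
      (euclidsLemma (p C k) (k ! * (p ∸ k) !) pp p∣pCk*k!*[p∸k]!)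
    where
    p : ℕ
    p = suc q
    instance
      k!*[p∸k]!≢0 : NonZero (k ! * (p ∸ k) !)
      k!*[p∸k]!≢0 = k !* (p ∸ k) !≢0
    p∣pCk*k!*[p∸k]! : p ∣ (p C k) * (k ! * (p ∸ k) !)
    p∣pCk*k!*[p∸k]! = subst (p ∣_) (sym (begin
      (p C k) * (k ! * (p ∸ k) !)
        ≡⟨ cong (_* (k ! * (p ∸ k) !)) (nCk≡n!/k![n-k]! (<⇒≤ k<p)) ⟩
      p ! / (k ! * (p ∸ k) !) * (k ! * (p ∸ k) !)
        ≡⟨ m/n*n≡m (k![n∸k]!∣n! (<⇒≤ k<p)) ⟩
      p !
        ∎)) (m∣m*n (q !))
      where open ≡-Reasoning
    p∤k!*[p∸k]! : p ∤ k ! * (p ∸ k) !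
    p∤k!*[p∸k]! = prime∤* pp (prime∤! pp k<p) (prime∤! pp (∸-monoʳ-< 0<k (<⇒≤ k<p)))

  fermat₂ : ∀ {p} → Prime p → p ≢ 2 → p ∣ 2 ^ (p ∸ 1) ∸ 1
  fermat₂ {suc q} pp p≢2 =
    [ (λ p∣2 → contradiction p∣2 (odd-prime∤2 pp p≢2)) , id ] (euclidsLemma 2 (2 ^ q ∸ 1) pp p∣2*[2^q∸1])
    where
    open ≡-Reasoning
    p : ℕ
    p = suc q
    middle : ℕ
    middle = ∑[ k < q ] (p C suc k)
    2^p≡2+middle : 2 ^ p ≡ 2 + middle
    2^p≡2+middle = begin
      2 ^ p                        ≡⟨ 2^n≡∑nCk p ⟩
      ∑[ k < suc p ] (p C k)       ≡⟨ ∑-suc p (p C_) ⟩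
      ∑[ k < p ] (p C k) + (p C p) ≡⟨ cong (∑< p (p C_) +_) (nCn≡1 p) ⟩
      1 + middle + 1               ≡⟨ +-comm (1 + middle) 1 ⟩
      2 + middle                   ∎
    p∣2*[2^q∸1] : p ∣ 2 * (2 ^ q ∸ 1)
    p∣2*[2^q∸1] = subst (p ∣_) (begin
      middle            ≡⟨ cong (_∸ 2) 2^p≡2+middle ⟨
      2 * 2 ^ q ∸ 2 * 1 ≡⟨ *-distribˡ-∸ 2 (2 ^ q) 1 ⟨
      2 * (2 ^ q ∸ 1)   ∎) (∑-∣ q _ (λ k<q → prime∣pCk pp z<s (s<s k<q)))

open import Data.Nat.Base as ℕ using (zero; suc; _<_)
import Data.Nat.Properties as ℕ
open import Data.Nat.Divisibility as ℕ using (_∤_)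
open import Data.Nat.Primality using (prime⇒irreducible; prime⇒nonZero)
open import Data.Nat.Coprimality as ℕ using (Coprime; coprime-Bézout)
import Data.Nat.GCD as ℕ
import Data.Nat.Tactic.RingSolver as ℕ-Solver
open import Data.Integer.Base using (NonZero; +_; -_; _+_; _-_; _*_; 0ℤ; 1ℤ; _⊖_; ∣_∣)
open import Data.Integer.Properties
  using (pos-+; pos-*; m-n≡m⊖n; ⊖-≥; *-zeroʳ; *-comm; neg-distribˡ-*; +-injective; i-j≡0⇒i≡j;
         ∣i∣≡0⇒i≡0; ∣m⊝n∣≤m⊔n)
open import Data.Integer.DivMod using (_%ℕ_; _/ℕ_; n%ℕd<d; a≡a%ℕn+[a/ℕn]*n)
open import Data.Integer.Coprimality using (coprime-divisor)
import Data.Integer.Divisibility as Unsigned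
open import Data.Integer.Divisibility.Signed
open import Data.Integer.Tactic.RingSolver using (solve-∀)

*-pres-∣ : ∀ {i j m n} → i ∣ m → j ∣ n → i * j ∣ m * n
*-pres-∣ {j = j} {m = m} i∣m j∣n = ∣-trans (*-monoˡ-∣ j i∣m) (*-monoʳ-∣ m j∣n)

-- The witness g is the geometric sum 1 + a + ⋯ + a^(m−1), which is ≡ m modulo d.
geometric-factor : ∀ {d} a → d ∣ + a - 1ℤ → ∀ m →
                   ∃[ g ] (+ (a ℕ.^ m) - 1ℤ ≡ (+ a - 1ℤ) * g × d ∣ g - + m)
geometric-factor a d∣a-1 zero = 0ℤ , sym (*-zeroʳ (+ a - 1ℤ)) , divides 0ℤ refl
geometric-factor {d} a d∣a-1 (suc m) with geometric-factor a d∣a-1 m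
... | g , aᵐ-1≡[a-1]g , d∣g-m = + a * g + 1ℤ , aᵐ⁺¹-1≡[a-1][ag+1] , d∣ag+1-[1+m]
  where
  open ≡-Reasoning
  A : ℤ
  A = + a
  split : ∀ A X → A * X - 1ℤ ≡ A * (X - 1ℤ) + (A - 1ℤ)
  split = solve-∀
  factor : ∀ A g → A * ((A - 1ℤ) * g) + (A - 1ℤ) ≡ (A - 1ℤ) * (A * g + 1ℤ)
  factor = solve-∀
  regroup : ∀ A g m → A * g + 1ℤ - (1ℤ + m) ≡ (A - 1ℤ) * g + (g - m)
  regroup = solve-∀
  aᵐ⁺¹-1≡[a-1][ag+1] : + (a ℕ.^ suc m) - 1ℤ ≡ (A - 1ℤ) * (A * g + 1ℤ)
  aᵐ⁺¹-1≡[a-1][ag+1] = begin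
    + (a ℕ.* a ℕ.^ m) - 1ℤ            ≡⟨ cong (_- 1ℤ) (pos-* a (a ℕ.^ m)) ⟩
    A * + (a ℕ.^ m) - 1ℤ              ≡⟨ split A (+ (a ℕ.^ m)) ⟩
    A * (+ (a ℕ.^ m) - 1ℤ) + (A - 1ℤ) ≡⟨ cong (λ x → A * x + (A - 1ℤ)) aᵐ-1≡[a-1]g ⟩
    A * ((A - 1ℤ) * g) + (A - 1ℤ)     ≡⟨ factor A g ⟩
    (A - 1ℤ) * (A * g + 1ℤ)           ∎
  d∣ag+1-[1+m] : d ∣ A * g + 1ℤ - + suc m
  d∣ag+1-[1+m] =
    subst (d ∣_) (trans (sym (regroup A g (+ m))) (cong (λ x → A * g + 1ℤ - x) (sym (pos-+ 1 m))))
      (∣m∣n⇒∣m+n (∣m⇒∣m*n g d∣a-1) d∣g-m)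

∣a-1⇒∣aᵐ-1 : ∀ {d} a m → d ∣ + a - 1ℤ → d ∣ + (a ℕ.^ m) - 1ℤ
∣a-1⇒∣aᵐ-1 a m d∣a-1 with geometric-factor a d∣a-1 m
... | g , aᵐ-1≡[a-1]g , _ = subst (_ ∣_) (sym aᵐ-1≡[a-1]g) (∣m⇒∣m*n g d∣a-1)

lift-exponent : ∀ {d} a n → d ∣ + a - 1ℤ → + n ∣ + a - 1ℤ → d * + n ∣ + (a ℕ.^ n) - 1ℤ
lift-exponent a n d∣a-1 n∣a-1 with geometric-factor a n∣a-1 n
... | g , aⁿ-1≡[a-1]g , n∣g-n =
  subst (_ ∣_) (sym aⁿ-1≡[a-1]g) (*-pres-∣ d∣a-1 (∣m+n∣n⇒∣m n∣g-n (∣m⇒∣-m ∣-refl)))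

expr-period : ∀ {d m} → d ∣ + (2 ℕ.^ m) - 1ℤ → ∀ j n t →
              d ∣ expr (j ℕ.* m ℕ.+ n) t - (expr n t + + (j ℕ.* m ℕ.* 2 ℕ.^ n))
expr-period {d} {m} d∣2ᵐ-1 j n t = subst (d ∣_) (sym expand) (∣n⇒∣m*n ((N + + n) * B) d∣A-1)
  where
  open ≡-Reasoning
  N A B : ℤ
  N = + (j ℕ.* m)
  A = + (2 ℕ.^ (j ℕ.* m))
  B = + (2 ℕ.^ n)
  d∣A-1 : d ∣ A - 1ℤ
  d∣A-1 = subst (λ e → d ∣ + e - 1ℤ) (trans (ℕ.^-*-assoc 2 m j) (cong (2 ℕ.^_) (ℕ.*-comm m j)))
            (∣a-1⇒∣aᵐ-1 (2 ℕ.^ m) j d∣2ᵐ-1)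
  factor : ∀ N n A B t → (N + n) * (A * B) - t - ((n * B - t) + N * B) ≡ (N + n) * B * (A - 1ℤ)
  factor = solve-∀
  expand : expr (j ℕ.* m ℕ.+ n) t - (expr n t + + (j ℕ.* m ℕ.* 2 ℕ.^ n)) ≡ (N + + n) * B * (A - 1ℤ)
  expand = begin
    + (j ℕ.* m ℕ.+ n) * + (2 ℕ.^ (j ℕ.* m ℕ.+ n)) - t - (expr n t + + (j ℕ.* m ℕ.* 2 ℕ.^ n))
      ≡⟨ cong₂ (λ x y → x - t - (expr n t + y))
           (cong₂ _*_ (pos-+ (j ℕ.* m) n)
                      (trans (cong +_ (ℕ.^-distribˡ-+-* 2 (j ℕ.* m) n)) (pos-* (2 ℕ.^ (j ℕ.* m)) (2 ℕ.^ n))))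
           (pos-* (j ℕ.* m) (2 ℕ.^ n)) ⟩
    (N + + n) * (A * B) - t - ((+ n * B - t) + N * B)
      ≡⟨ factor N (+ n) A B t ⟩
    (N + + n) * B * (A - 1ℤ) ∎

+[m∸1]≡+m-1 : ∀ {m} → 0 < m → + (m ∸ 1) ≡ + m - 1ℤ
+[m∸1]≡+m-1 {m} 0<m = trans (sym (⊖-≥ 0<m)) (sym (m-n≡m⊖n m 1))

1+m*n≡o*p⇒ℤ : ∀ m n o p → 1 ℕ.+ m ℕ.* n ≡ o ℕ.* p → 1ℤ + + m * + n ≡ + o * + p
1+m*n≡o*p⇒ℤ m n o p eq = begin
  1ℤ + + m * + n       ≡⟨ cong (λ z → 1ℤ + z) (pos-* m n) ⟨
  1ℤ + + (m ℕ.* n)     ≡⟨ pos-+ 1 (m ℕ.* n) ⟨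
  + (1 ℕ.+ m ℕ.* n)    ≡⟨ cong +_ eq ⟩
  + (o ℕ.* p)          ≡⟨ pos-* o p ⟩
  + o * + p            ∎
  where open ≡-Reasoning

prime∤⇒coprime : ∀ {p n} → Prime p → p ∤ n → Coprime p n
prime∤⇒coprime pp p∤n (d∣p , d∣n) =
  [ id , (λ { refl → contradiction d∣n p∤n }) ] (prime⇒irreducible pp d∣p)

inverse-mod-prime : ∀ {p a} → Prime p → p ∤ a → ∃[ u ] + p ∣ + a * u - 1ℤ
inverse-mod-prime {p} {a} pp p∤a with coprime-Bézout (prime∤⇒coprime pp p∤a)
... | ℕ.Bézout.+- x y 1+ya≡xp = - + y , divides (- + x) (begin
  + a * - + y - 1ℤ      ≡⟨ negate (+ a) (+ y) ⟩
  - (1ℤ + + y * + a)    ≡⟨ cong -_ (1+m*n≡o*p⇒ℤ y a x p 1+ya≡xp) ⟩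
  - (+ x * + p)         ≡⟨ neg-distribˡ-* (+ x) (+ p) ⟩
  - + x * + p           ∎)
  where
  open ≡-Reasoning
  negate : ∀ A Y → A * - Y - 1ℤ ≡ - (1ℤ + Y * A)
  negate = solve-∀
... | ℕ.Bézout.-+ x y 1+xp≡ya = + y , divides (+ x) (begin
  + a * + y - 1ℤ         ≡⟨ cong (_- 1ℤ) (*-comm (+ a) (+ y)) ⟩
  + y * + a - 1ℤ         ≡⟨ cong (_- 1ℤ) (1+m*n≡o*p⇒ℤ x p y a 1+xp≡ya) ⟨
  1ℤ + + x * + p - 1ℤ    ≡⟨ cancel (+ x * + p) ⟩
  + x * + p              ∎)
  where
  open ≡-Reasoning
  cancel : ∀ X → 1ℤ + X - 1ℤ ≡ X
  cancel = solve-∀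

∣∣m⊖n∣⇒m≡n : ∀ {d m n} → m < d → n < d → d ℕ.∣ ∣ m ⊖ n ∣ → m ≡ n
∣∣m⊖n∣⇒m≡n {d} {m} {n} m<d n<d d∣∣m⊖n∣ with ∣ m ⊖ n ∣ in ∣m⊖n∣≡
... | zero  = +-injective (i-j≡0⇒i≡j (+ m) (+ n) (trans (m-n≡m⊖n m n) (∣i∣≡0⇒i≡0 ∣m⊖n∣≡)))
... | suc _ = contradiction d∣∣m⊖n∣
  (ℕ.>⇒∤ (ℕ.≤-<-trans (subst (ℕ._≤ m ℕ.⊔ n) ∣m⊖n∣≡ (∣m⊝n∣≤m⊔n m n)) (ℕ.⊔-pres-<m m<d n<d)))

module _ {p a} (pp : Prime p) (p∤a : p ∤ a) where

  private instance
    p≢0 : ℕ.NonZero p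
    p≢0 = prime⇒nonZero pp

  linear-congruence-solvable : ∀ c → ∃[ j ] (j < p × + p ∣ c + + j * + a)
  linear-congruence-solvable c with inverse-mod-prime pp p∤a
  ... | u , p∣au-1 = j , n%ℕd<d x p , subst (+ p ∣_) (sym c+ja≡) p∣
    where
    open ≡-Reasoning
    x q : ℤ
    x = - (c * u)
    q = x /ℕ p
    j : ℕ
    j = x %ℕ p
    shift : ∀ c j q A P → c + j * A ≡ c + (j + q * P) * A - q * A * P
    shift = solve-∀
    regroup : ∀ c u q A P → c + - (c * u) * A - q * A * P ≡ - c * (A * u - 1ℤ) - q * A * P
    regroup = solve-∀
    c+ja≡ : c + + j * + a ≡ - c * (+ a * u - 1ℤ) - q * + a * + p
    c+ja≡ = begin
      c + + j * + a
        ≡⟨ shift c (+ j) q (+ a) (+ p) ⟩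
      c + (+ j + q * + p) * + a - q * + a * + p
        ≡⟨ cong (λ y → c + y * + a - q * + a * + p) (a≡a%ℕn+[a/ℕn]*n x p) ⟨
      c + x * + a - q * + a * + p
        ≡⟨ regroup c u q (+ a) (+ p) ⟩
      - c * (+ a * u - 1ℤ) - q * + a * + p
        ∎
    p∣ : + p ∣ - c * (+ a * u - 1ℤ) - q * + a * + p
    p∣ = ∣m∣n⇒∣m-n (∣n⇒∣m*n (- c) p∣au-1) (∣n⇒∣m*n (q * + a) ∣-refl)

  linear-congruence-unique : ∀ {c j j′} → j < p → j′ < p →
                             + p ∣ c + + j * + a → + p ∣ c + + j′ * + a → j ≡ j′
  linear-congruence-unique {c} {j} {j′} j<p j′<p p∣c+ja p∣c+j′a =
    ∣∣m⊖n∣⇒m≡n j<p j′<p (subst (λ z → p ℕ.∣ ∣ z ∣) (m-n≡m⊖n j j′) p∣j-j′)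
    where
    difference : ∀ c j j′ A → c + j * A - (c + j′ * A) ≡ A * (j - j′)
    difference = solve-∀
    p∣j-j′ : p ℕ.∣ ∣ + j - + j′ ∣
    p∣j-j′ = coprime-divisor (+ p) (+ a) (+ j - + j′) (prime∤⇒coprime pp p∤a)
      (∣⇒∣ᵤ (subst (+ p ∣_) (difference c (+ j) (+ j′) (+ a)) (∣m∣n⇒∣m-n p∣c+ja p∣c+j′a)))

module OddPrime {p} (pp : Prime p) (p≢2 : p ≢ 2) where

  private instance
    p≢0 : ℕ.NonZero p
    p≢0 = prime⇒nonZero pp

  M : ℕ → ℕ
  M k = p ℕ.^ k ℕ.* (p ∸ 1)

  2^M≡1 : ∀ k → + (p ℕ.^ suc k) ∣ + (2 ℕ.^ M k) - 1ℤ
  2^M≡1 zero =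
    subst₂ (λ x y → + x ∣ + (2 ℕ.^ y) - 1ℤ) (sym (ℕ.*-identityʳ p)) (sym (ℕ.+-identityʳ (p ∸ 1)))
      (subst (+ p ∣_) (+[m∸1]≡+m-1 (ℕ.m^n>0 2 (p ∸ 1))) (∣ᵤ⇒∣ (fermat₂ pp p≢2)))
  2^M≡1 (suc k) = subst₂ (λ x y → x ∣ + y - 1ℤ) p^[1+k]*p≡p^[2+k] [2^M]^p≡2^M′
    (lift-exponent (2 ℕ.^ M k) p (2^M≡1 k) (∣-trans p∣p^[1+k] (2^M≡1 k)))
    where
    p∣p^[1+k] : + p ∣ + (p ℕ.^ suc k)
    p∣p^[1+k] = ∣ᵤ⇒∣ (ℕ.m∣m*n (p ℕ.^ k))
    p^[1+k]*p≡p^[2+k] : + (p ℕ.^ suc k) * + p ≡ + (p ℕ.^ suc (suc k))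
    p^[1+k]*p≡p^[2+k] = trans (sym (pos-* (p ℕ.^ suc k) p)) (cong +_ (ℕ.*-comm (p ℕ.^ suc k) p))
    M[k]*p≡M[1+k] : M k ℕ.* p ≡ M (suc k)
    M[k]*p≡M[1+k] = trans (ℕ.*-comm (M k) p) (sym (ℕ.*-assoc p (p ℕ.^ k) (p ∸ 1)))
    [2^M]^p≡2^M′ : (2 ℕ.^ M k) ℕ.^ p ≡ 2 ℕ.^ M (suc k)
    [2^M]^p≡2^M′ = trans (ℕ.^-*-assoc 2 (M k) p) (cong (2 ℕ.^_) M[k]*p≡M[1+k])

  a : ℕ → ℕ
  a n = (p ∸ 1) ℕ.* 2 ℕ.^ n

  p∤a : ∀ n → p ∤ a n
  p∤a n = prime∤* pp (prime∤p∸1 pp) (prime∤^ pp (odd-prime∤2 pp p≢2) n)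

  jM2ⁿ≡ja·pᵏ : ∀ k j n → + (j ℕ.* M k ℕ.* 2 ℕ.^ n) ≡ + j * + a n * + (p ℕ.^ k)
  jM2ⁿ≡ja·pᵏ k j n = begin
    + (j ℕ.* M k ℕ.* 2 ℕ.^ n)          ≡⟨ cong +_ (rearrange j (p ℕ.^ k) (p ∸ 1) (2 ℕ.^ n)) ⟩
    + (j ℕ.* a n ℕ.* p ℕ.^ k)          ≡⟨ pos-* (j ℕ.* a n) (p ℕ.^ k) ⟩
    + (j ℕ.* a n) * + (p ℕ.^ k)        ≡⟨ cong (_* + (p ℕ.^ k)) (pos-* j (a n)) ⟩
    + j * + a n * + (p ℕ.^ k)          ∎
    where
    open ≡-Reasoning
    rearrange : ∀ j P q B → j ℕ.* (P ℕ.* q) ℕ.* B ≡ j ℕ.* (q ℕ.* B) ℕ.* P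
    rearrange = ℕ-Solver.solve-∀

  module _ (t : ℤ) where

    Solution? : ∀ k n → Dec (+ (p ℕ.^ k) Unsigned.∣ expr n t)
    Solution? k n = (+ (p ℕ.^ k)) ∣ℤ? expr n t

    Lift? : ∀ k n j → Dec (+ (p ℕ.^ suc k) Unsigned.∣ expr (j ℕ.* M k ℕ.+ n) t)
    Lift? k n j = Solution? (suc k) (j ℕ.* M k ℕ.+ n)

    fibre-none : ∀ k n j → ¬ (+ (p ℕ.^ k) ∣ expr n t) → ¬ (+ (p ℕ.^ suc k) ∣ expr (j ℕ.* M k ℕ.+ n) t)
    fibre-none k n j p^k∤eₙ p^[1+k]∣F = p^k∤eₙ (∣m+n∣n⇒∣m p^k∣eₙ+X p^k∣X)
      where
      F X : ℤ
      F = expr (j ℕ.* M k ℕ.+ n) t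
      X = + (j ℕ.* M k ℕ.* 2 ℕ.^ n)
      p^k∣p^[1+k] : + (p ℕ.^ k) ∣ + (p ℕ.^ suc k)
      p^k∣p^[1+k] = ∣ᵤ⇒∣ (ℕ.n∣m*n p)
      p^k∣X : + (p ℕ.^ k) ∣ X
      p^k∣X = subst (+ (p ℕ.^ k) ∣_) (sym (jM2ⁿ≡ja·pᵏ k j n)) (∣n⇒∣m*n (+ j * + a n) ∣-refl)
      cancel : ∀ F e X → F - (F - (e + X)) ≡ e + X
      cancel = solve-∀
      p^k∣eₙ+X : + (p ℕ.^ k) ∣ expr n t + X
      p^k∣eₙ+X = subst (_ ∣_) (cancel F (expr n t) X)
        (∣m∣n⇒∣m-n (∣-trans p^k∣p^[1+k] p^[1+k]∣F) (∣-trans p^k∣p^[1+k] (expr-period (2^M≡1 k) j n t)))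

    fibre-lift : ∀ k n j c → expr n t ≡ c * + (p ℕ.^ k) →
                 (+ (p ℕ.^ suc k) ∣ expr (j ℕ.* M k ℕ.+ n) t) ⇔ (+ p ∣ c + + j * + a n)
    fibre-lift k n j c eₙ≡cpᵏ = mk⇔
      (λ p^[1+k]∣F → *-cancelʳ-∣ P (subst (_∣ C * P) p^[1+k]≡p*pᵏ
                        (∣m+n∣m⇒∣n (subst (_ ∣_) F≡E+C*pᵏ p^[1+k]∣F) p^[1+k]∣E)))
      (λ p∣C → subst (_ ∣_) (sym F≡E+C*pᵏ)
                  (∣m∣n⇒∣m+n p^[1+k]∣E (subst (_∣ C * P) (sym p^[1+k]≡p*pᵏ) (*-monoˡ-∣ P p∣C))))
      where
      open ≡-Reasoning
      instance
        pᵏ≢0 : NonZero (+ (p ℕ.^ k))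
        pᵏ≢0 = ℕ.m^n≢0 p k
      P F X E C : ℤ
      P = + (p ℕ.^ k)
      F = expr (j ℕ.* M k ℕ.+ n) t
      X = + (j ℕ.* M k ℕ.* 2 ℕ.^ n)
      E = F - (expr n t + X)
      C = c + + j * + a n
      p^[1+k]∣E : + (p ℕ.^ suc k) ∣ E
      p^[1+k]∣E = expr-period (2^M≡1 k) j n t
      p^[1+k]≡p*pᵏ : + (p ℕ.^ suc k) ≡ + p * P
      p^[1+k]≡p*pᵏ = pos-* p (p ℕ.^ k)
      split : ∀ F Y → F ≡ F - Y + Y
      split = solve-∀
      collect : ∀ E c P J A → E + (c * P + J * A * P) ≡ E + (c + J * A) * P
      collect = solve-∀
      F≡E+C*pᵏ : F ≡ E + C * P
      F≡E+C*pᵏ = begin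
        F                                  ≡⟨ split F (expr n t + X) ⟩
        E + (expr n t + X)                 ≡⟨ cong₂ (λ y z → E + (y + z)) eₙ≡cpᵏ (jM2ⁿ≡ja·pᵏ k j n) ⟩
        E + (c * P + + j * + a n * P)      ≡⟨ collect E c P (+ j) (+ a n) ⟩
        E + C * P                          ∎

    fibre-count-yes : ∀ k n → + (p ℕ.^ k) ∣ expr n t →
                      count (Lift? k n) p ≡ 1
    fibre-count-yes k n (divides c eₙ≡cpᵏ) = unique-lift (linear-congruence-solvable pp (p∤a n) c)
      where
      unique-lift : ∃[ j₀ ] (j₀ < p × + p ∣ c + + j₀ * + a n) →
                    count (Lift? k n) p ≡ 1
      unique-lift (j₀ , j₀<p , p∣c+j₀a) =
        count-unique (Lift? k n) j₀<p
          (∣⇒∣ᵤ (Equivalence.from (fibre-lift k n j₀ c eₙ≡cpᵏ) p∣c+j₀a))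
          (λ {j} j<p sol → linear-congruence-unique pp (p∤a n) {c} {j} {j₀} j<p j₀<p
                             (Equivalence.to (fibre-lift k n j c eₙ≡cpᵏ) (∣ᵤ⇒∣ sol)) p∣c+j₀a)

    fibre-count-no : ∀ k n → ¬ (+ (p ℕ.^ k) ∣ expr n t) →
                     count (Lift? k n) p ≡ 0
    fibre-count-no k n p^k∤eₙ =
      count-none (Lift? k n) p
        (λ {j} _ → fibre-none k n j p^k∤eₙ ∘ ∣ᵤ⇒∣)

    fibre-count : ∀ k n → count (Lift? k n) p ≡ 𝟙 (Solution? k n)
    fibre-count k n = 𝟙-cases (Solution? k n)
      (fibre-count-yes k n ∘ ∣ᵤ⇒∣) (λ p^k∤eₙ → fibre-count-no k n (p^k∤eₙ ∘ ∣⇒∣ᵤ))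

    count-step : ∀ k → count (Solution? (suc k)) (M (suc k)) ≡ count (Solution? k) (M k)
    count-step k = begin
      count (Solution? (suc k)) (M (suc k))
        ≡⟨ cong (count (Solution? (suc k))) (ℕ.*-assoc p (p ℕ.^ k) (p ∸ 1)) ⟩
      ∑[ n < p ℕ.* M k ] 𝟙 (Solution? (suc k) n)
        ≡⟨ ∑-blocks p (M k) _ ⟩
      ∑[ j < p ] ∑[ n < M k ] 𝟙 (Lift? k n j)
        ≡⟨ ∑-comm p (M k) _ ⟩
      ∑[ n < M k ] count (Lift? k n) p
        ≡⟨ ∑-cong (M k) (λ {n} _ → fibre-count k n) ⟩
      count (Solution? k) (M k)
        ∎
      where open ≡-Reasoning

    count-solutions : ∀ k → count (Solution? k) (M k) ≡ p ∸ 1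
    count-solutions zero    = trans (count-all _ (M 0) (λ _ → ℕ.1∣ _)) (ℕ.+-identityʳ (p ∸ 1))
    count-solutions (suc k) = trans (count-step k) (count-solutions k)

lemma2p11 : (k : ℕ) → k ≥ 1 → (t : ℤ) → (p : ℕ) → Prime p → p ≢ 2 →
            length (solutions p k t) ≡ p ∸ 1
lemma2p11 k _ t p pp p≢2 =
  trans (length-filter-applyUpTo (Solution? t k) id (M k)) (count-solutions t k)
  where open OddPrime pp p≢2
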